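{- There exist an instance of unlabeled MAPF on a tree and a choice of root $r$ such that the plan produced by $\mathit{process\_subtree}(r)$ has makespan strictly larger than the minimum makespan of a feasible plan, and sum of costs strictly larger than the minimum sum of costs of a feasible plan.
   Context: Unlabeled MAPF on a tree: tree $T=(V,E)$ with $n$ nodes; $k$ agents on distinct start nodes; $k$ distinct targets (may coincide with start nodes); any agent may end at any target. Discrete time; each timestep each agent waits or moves to an adjacent node; a plan is feasible if no two agents share a node at the same time, no two agents traverse an edge in opposite directions in the same timestep, and eventually all agents rest on targets. Path length of an agent = number of timesteps (moves and waits) until it arrives at its final target for the last time; makespan = max, sum of costs = sum over agents. Fix root $r$; $T_u$ the subtree at $u$; $agent(u),target(u)\in\{0,1\}$; demand $d(u)=\sum_{v\in T_u}target(v)-\sum_{v\in T_u}agent(v)$. Each node has a list $l(u)$ (initially empty; $\max$ of empty list $=0$) and integer $s(u)$ (initially $0$). $\mathit{send\_agent}(u,t)$: if $d(u)<0$: append $t+1$ to $l(parent(u))$, output move $(u,parent(u),t)$, $d(u)\gets d(u)+1$; else if some child $v$ has $d(v)>0$: pick one, append $t+1$ to $l(v)$, output move $(u,v,t)$, $d(v)\gets d(v)-1$; else nothing. $\mathit{process\_subtree}(u)$: if $agent(u)=1$ insert $s(u)$ at the start of $l(u)$; for each child $v$ with $d(v)<0$: $s(v)\gets\max(s(u)-1,\max l(u),0)$, call $\mathit{process\_subtree}(v)$; for each $t\in l(u)$ in order call $\mathit{send\_agent}(u,t)$; mark $u$ processed; call $\mathit{process\_subtree}(v)$ for each unprocessed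 child $v$. Move $(u,v,t)$ means an agent leaves $u$ at time $t$ arriving at $v$ at $t+1$; agents wait at their start before their first move and stay after their last move. -}

module Defs where

open import Data.Nat using (ℕ; zero; suc; _∸_; _⊔_; _≡ᵇ_; _<_)
open import Data.Integer as ℤ using (ℤ; 0ℤ; 1ℤ)
open import Data.Integer.Properties using () renaming (_<?_ to _<ℤ?_)
open import Data.Bool using (Bool; true; false; if_then_else_)
open import Data.Nat.ListAction using (sum)
open import Data.List using (List; []; _∷_; _∷ʳ_; map; foldr; length; upTo; lookup; allFin; _++_; concatMap)
open import Data.List.Membership.Propositional using (_∈_)
open import Data.List.Relation.Unary.All using (All)
open import Data.Maybe using (Maybe; just; nothing)
open import Data.Fin using (Fin)
open import Data.Product using (_×_; _,_; Σ)
open import Data.Sum using (_⊎_)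
open import Data.Unit using (⊤)
open import Data.Empty using (⊥)
open import Relation.Nullary.Decidable using (⌊_⌋)
open import Relation.Binary.PropositionalEquality using (_≡_; _≢_)

-- Instances: a finite tree, given rooted at the chosen root r, each node
-- carrying agent(u) and target(u).  Children are ordered (this order is
-- the order in which "for each child" / "pick one" are resolved).

data Tree : Set where
  node : (agent target : Bool) → List Tree → Tree

-- The same tree with nodes numbered 0,1,2,... in preorder (root r = 0).
data LTree : Set where
  lnode : (id : ℕ) (agent target : Bool) → List LTree → LTree

mutual
  numberT : ℕ → Tree → LTree × ℕ
  numberT n (node a b cs) with numberF (suc n) cs
  ... | cs' , m = lnode n a b cs' , m

  numberF : ℕ → List Tree → List LTree × ℕ
  numberF n [] = [] , n
  numberF n (c ∷ cs) with numberT n c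
  ... | c' , m with numberF m cs
  ...   | cs' , m' = c' ∷ cs' , m'

label : Tree → LTree
label t with numberT 0 t
... | lt , _ = lt

idOf : LTree → ℕ
idOf (lnode u _ _ _) = u

bit : Bool → ℤ
bit true = 1ℤ
bit false = 0ℤ

mutual
  nodesT : LTree → List LTree
  nodesT (lnode u a b cs) = lnode u a b cs ∷ nodesF cs

  nodesF : List LTree → List LTree
  nodesF [] = []
  nodesF (c ∷ cs) = nodesT c ++ nodesF cs

  demandT : LTree → ℤ
  demandT (lnode _ a b cs) = (bit b ℤ.- bit a) ℤ.+ demandF cs

  demandF : List LTree → ℤ
  demandF [] = 0ℤ
  demandF (c ∷ cs) = demandT c ℤ.+ demandF cs

edges : LTree → List (ℕ × ℕ)
edges t = concatMap (λ { (lnode u _ _ cs) → map (λ c → u , idOf c) cs }) (nodesT t)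

Adj : LTree → ℕ → ℕ → Set
Adj t u v = ((u , v) ∈ edges t) ⊎ ((v , u) ∈ edges t)

agentNodes : LTree → List ℕ
agentNodes t = concatMap (λ { (lnode u a _ _) → if a then u ∷ [] else [] }) (nodesT t)

targetNodes : LTree → List ℕ
targetNodes t = concatMap (λ { (lnode u _ b _) → if b then u ∷ [] else [] }) (nodesT t)

agents : LTree → ℕ
agents t = length (agentNodes t)

startPos : (t : LTree) → Fin (agents t) → ℕ
startPos t i = lookup (agentNodes t) i

ValidInstance : LTree → Set
ValidInstance t = length (agentNodes t) ≡ length (targetNodes t)

-- Plans: sequence of configurations at times 0,1,...,m; after time m all
-- agents stay where they are forever.

Config : ℕ → Set
Config k = Fin k → ℕ

Plan : ℕ → Set
Plan k = List (Config k)

trajectory : ∀ {k} → Plan k → Fin k → List ℕ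
trajectory P i = map (λ c → c i) P

allEq : ℕ → List ℕ → Bool
allEq x [] = true
allEq x (y ∷ ys) = (x ≡ᵇ y) Data.Bool.∧ allEq x ys

pathLen : List ℕ → ℕ
pathLen [] = 0
pathLen (x ∷ xs) = if allEq x xs then 0 else suc (pathLen xs)

makespan : ∀ {k} → Plan k → ℕ
makespan {k} P = foldr _⊔_ 0 (map (λ i → pathLen (trajectory P i)) (allFin k))

sumOfCosts : ∀ {k} → Plan k → ℕ
sumOfCosts {k} P = sum (map (λ i → pathLen (trajectory P i)) (allFin k))

NoVertexConflict : ∀ {k} → Config k → Set
NoVertexConflict {k} c = (i j : Fin k) → c i ≡ c j → i ≡ j

ValidStep : (t : LTree) → Config (agents t) → Config (agents t) → Set
ValidStep t c d =
  ((i : Fin (agents t)) → (c i ≡ d i) ⊎ Adj t (c i) (d i)) ×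
  ((i j : Fin (agents t)) → c i ≢ d i → c i ≡ d j → c j ≡ d i → ⊥)

StepsOK : (t : LTree) → Plan (agents t) → Set
StepsOK t [] = ⊤
StepsOK t (c ∷ []) = ⊤
StepsOK t (c ∷ d ∷ P) = ValidStep t c d × StepsOK t (d ∷ P)

StartOK : (t : LTree) → Plan (agents t) → Set
StartOK t [] = ⊥
StartOK t (c ∷ _) = (i : Fin (agents t)) → c i ≡ startPos t i

EndOK : (t : LTree) → Plan (agents t) → Set
EndOK t [] = ⊥
EndOK t (c ∷ []) = (i : Fin (agents t)) → c i ∈ targetNodes t
EndOK t (c ∷ d ∷ P) = EndOK t (d ∷ P)

record Feasible (t : LTree) (P : Plan (agents t)) : Set where
  field
    start     : StartOK t P
    steps     : StepsOK t P
    noVertex  : All NoVertexConflict P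
    end       : EndOK t P

Move : Set
Move = ℕ × ℕ × ℕ

record State : Set where
  field
    d         : ℕ → ℤ
    l         : ℕ → List ℕ
    s         : ℕ → ℕ
    processed : ℕ → Bool
    out       : List Move
open State

upd : {A : Set} → (ℕ → A) → ℕ → A → ℕ → A
upd f u a v = if v ≡ᵇ u then a else f v

maxL : List ℕ → ℕ
maxL = foldr _⊔_ 0

sendDown : ℕ → List ℕ → ℕ → State → State
sendDown u [] t st = st
sendDown u (v ∷ vs) t st =
  if ⌊ 0ℤ <ℤ? d st v ⌋
  then record st { l = upd (l st) v (l st v ∷ʳ suc t)
                 ; out = out st ∷ʳ (u , v , t)
                 ; d = upd (d st) v (d st v ℤ.- 1ℤ) }
  else sendDown u vs t st

-- send_agent(u,t); the root (no parent) never takes the first branch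
sendAgent : ℕ → Maybe ℕ → List ℕ → ℕ → State → State
sendAgent u nothing vs t st = sendDown u vs t st
sendAgent u (just p) vs t st =
  if ⌊ d st u <ℤ? 0ℤ ⌋
  then record st { l = upd (l st) p (l st p ∷ʳ suc t)
                 ; out = out st ∷ʳ (u , p , t)
                 ; d = upd (d st) u (d st u ℤ.+ 1ℤ) }
  else sendDown u vs t st

sendAll : ℕ → Maybe ℕ → List ℕ → List ℕ → State → State
sendAll u p vs [] st = st
sendAll u p vs (t ∷ ts) st = sendAll u p vs ts (sendAgent u p vs t st)

mutual
  processSubtree : Maybe ℕ → LTree → State → State
  processSubtree p (lnode u a b cs) st =
    let st1 = if a then record st { l = upd (l st) u (s st u ∷ l st u) } else st
        st2 = negLoop u cs st1
        st3 = sendAll u p (map idOf cs) (l st2 u) st2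
        st4 = record st3 { processed = upd (processed st3) u true }
    in restLoop u cs st4

  negLoop : ℕ → List LTree → State → State
  negLoop u [] st = st
  negLoop u (lnode v a b vs ∷ cs) st =
    if ⌊ d st v <ℤ? 0ℤ ⌋
    then negLoop u cs (processSubtree (just u) (lnode v a b vs)
                         (record st { s = upd (s st) v ((s st u ∸ 1) ⊔ maxL (l st u)) }))
    else negLoop u cs st

  restLoop : ℕ → List LTree → State → State
  restLoop u [] st = st
  restLoop u (lnode v a b vs ∷ cs) st =
    if processed st v
    then restLoop u cs st
    else restLoop u cs (processSubtree (just u) (lnode v a b vs) st)

initState : LTree → State
initState t = record
  { d = λ v → demandF (Data.List.filter (λ n → v Data.Nat.≟ idOf n) (nodesT t))
  ; l = λ _ → []
  ; s = λ _ → 0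
  ; processed = λ _ → false
  ; out = [] }

algMoves : LTree → List Move
algMoves t = out (processSubtree nothing t (initState t))

moveFrom : List Move → ℕ → ℕ → ℕ
moveFrom [] τ p = p
moveFrom ((u , v , τ') ∷ ms) τ p =
  if (u ≡ᵇ p) Data.Bool.∧ (τ' ≡ᵇ τ) then v else moveFrom ms τ p

horizon : List Move → ℕ
horizon = foldr (λ { (_ , _ , τ) acc → suc τ ⊔ acc }) 0

configAt : (t : LTree) → List Move → ℕ → Config (agents t)
configAt t ms zero i = startPos t i
configAt t ms (suc τ) i = moveFrom ms τ (configAt t ms τ i)

algPlan : (t : LTree) → Plan (agents t)
algPlan t = map (configAt t (algMoves t)) (upTo (suc (horizon (algMoves t))))

-- On the tree  1 — 0 — 4  with a pendant path  0 — 2 — 3,  targets at 0 and 1 and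
-- agents at 3 and 4 (root 0), the algorithm handles the negative-demand child 2
-- first: its agent reaches 0 at time 2 and is sent on to 1, and because s(4) is set
-- to at least max l(0) = 2, the agent at 4 is held back until then.  The output
-- moves are (3,2,0), (2,0,1), (4,0,2), (0,1,2), so both agents finish at time 3.
-- Sending 4 → 0 → 1 while 3 → 2 → 0 finishes both at time 2, so the algorithm is
-- suboptimal for makespan (3 > 2) and sum of costs (6 > 4).
module Submission where

open import Defs
open import Data.Nat using (ℕ; _<_; _≟_; s≤s; z≤n)
open import Data.Bool using (true; false)
open import Data.Empty using (⊥)
open import Data.Fin using (Fin; zero; suc)
open import Data.List using ([]; _∷_)
open import Data.List.Relation.Unary.All using ([]; _∷_)
open import Data.List.Relation.Unary.Any using (here; there)
open import Data.Product using (Σ; _×_; _,_)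
open import Data.Product.Properties using (≡-dec)
open import Data.List.Membership.DecPropositional (≡-dec _≟_ _≟_) using (_∈?_)
open import Data.Sum using (inj₁; inj₂)
open import Data.Unit using (tt)
open import Relation.Binary.PropositionalEquality using (_≡_; _≢_; refl; sym)
open import Relation.Nullary.Decidable using (True; toWitness)

NoVertexConflict-pair : (c : Config 2) → c zero ≢ c (suc zero) → NoVertexConflict c
NoVertexConflict-pair c c₀≢c₁ zero zero _ = refl
NoVertexConflict-pair c c₀≢c₁ zero (suc zero) c₀≡c₁ with () ← c₀≢c₁ c₀≡c₁
NoVertexConflict-pair c c₀≢c₁ (suc zero) zero c₁≡c₀ with () ← c₀≢c₁ (sym c₁≡c₀)
NoVertexConflict-pair c c₀≢c₁ (suc zero) (suc zero) _ = refl

NoSwapConflict-pair : (c d : Config 2) → (c zero ≡ d (suc zero) → c (suc zero) ≡ d zero → ⊥) →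
  (i j : Fin 2) → c i ≢ d i → c i ≡ d j → c j ≡ d i → ⊥
NoSwapConflict-pair c d noSwap zero zero moved stayed _ = moved stayed
NoSwapConflict-pair c d noSwap zero (suc zero) _ c₀≡d₁ c₁≡d₀ = noSwap c₀≡d₁ c₁≡d₀
NoSwapConflict-pair c d noSwap (suc zero) zero _ c₁≡d₀ c₀≡d₁ = noSwap c₀≡d₁ c₁≡d₀
NoSwapConflict-pair c d noSwap (suc zero) (suc zero) moved stayed _ = moved stayed

counterexample : Tree
counterexample =
  node false true
    ( node false true []
    ∷ node false false (node true false [] ∷ [])
    ∷ node true false []
    ∷ [])

instance₀ : LTree
instance₀ = label counterexample

Adj-toChild : ∀ u v → {True ((u , v) ∈? edges instance₀)} → Adj instance₀ u v
Adj-toChild u v {uv∈E} = inj₁ (toWitness uv∈E)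

Adj-toParent : ∀ u v → {True ((v , u) ∈? edges instance₀)} → Adj instance₀ u v
Adj-toParent u v {vu∈E} = inj₂ (toWitness vu∈E)

makespan-algPlan : makespan (algPlan instance₀) ≡ 3
makespan-algPlan = refl

sumOfCosts-algPlan : sumOfCosts (algPlan instance₀) ≡ 6
sumOfCosts-algPlan = refl

config : ℕ → ℕ → Config 2
config p q zero = p
config p q (suc zero) = q

directPlan : Plan (agents instance₀)
directPlan = config 3 4 ∷ config 2 0 ∷ config 0 1 ∷ []

directPlan-feasible : Feasible instance₀ directPlan
directPlan-feasible = record
  { start = λ { zero → refl ; (suc zero) → refl }
  ; steps = ( (λ { zero → inj₂ (Adj-toParent 3 2) ; (suc zero) → inj₂ (Adj-toParent 4 0) })
            , NoSwapConflict-pair (config 3 4) (config 2 0) (λ ()) )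
          , ( (λ { zero → inj₂ (Adj-toParent 2 0) ; (suc zero) → inj₂ (Adj-toChild 0 1) })
            , NoSwapConflict-pair (config 2 0) (config 0 1) (λ ()) )
          , tt
  ; noVertex = NoVertexConflict-pair _ (λ ()) ∷ NoVertexConflict-pair _ (λ ())
             ∷ NoVertexConflict-pair _ (λ ()) ∷ []
  ; end = λ { zero → here refl ; (suc zero) → there (here refl) } }

makespan-directPlan : makespan directPlan ≡ 2
makespan-directPlan = refl

sumOfCosts-directPlan : sumOfCosts directPlan ≡ 4
sumOfCosts-directPlan = refl

mainTheorem13 : Σ Tree (λ T →
    ValidInstance (label T) ×
    Σ (Plan (agents (label T))) (λ P → Feasible (label T) P × makespan P < makespan (algPlan (label T))) ×
    Σ (Plan (agents (label T))) (λ Q → Feasible (label T) Q × sumOfCosts Q < sumOfCosts (algPlan (label T))))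
mainTheorem13 =
  counterexample , refl
  , (directPlan , directPlan-feasible , 2<3)
  , (directPlan , directPlan-feasible , 4<6)
  where
  2<3 : makespan directPlan < makespan (algPlan instance₀)
  2<3 rewrite makespan-directPlan | makespan-algPlan = s≤s (s≤s (s≤s z≤n))
  4<6 : sumOfCosts directPlan < sumOfCosts (algPlan instance₀)
  4<6 rewrite sumOfCosts-directPlan | sumOfCosts-algPlan = s≤s (s≤s (s≤s (s≤s (s≤s z≤n))))
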